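{- Every signed triangular grid $G$ satisfies $\chi_s(G)\le 10$.
   Context: A signed graph $G=(V,E,s)$ is a finite simple graph (no loops, no parallel edges) with a signature $s:E\to\{ -1,+1\}$ (positive and negative edges). Switching a vertex $v$ reverses the sign of every edge incident to $v$. A homomorphism of signed graphs $G\to H$ is a map $\varphi:V(G)\to V(H)$ such that, after switching some subset of the vertices of $G$, every edge $uv$ of $G$ is mapped to an edge $\varphi(u)\varphi(v)$ of $H$ with the same sign. The chromatic number $\chi_s(G)$ of a signed graph $G$ is the minimum order of a signed graph $H$ such that $G$ admits a homomorphism to $H$. A triangular grid is a finite induced subgraph of the (infinite) graph of the tiling of the plane by equilateral triangles; a signed triangular grid is a triangular grid with an arbitrary signature. -}

module Defs where

open import Data.Nat using (ℕ; _≤_)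
open import Data.Fin using (Fin)
open import Data.Integer using (ℤ; +_; -[1+_]; _+_; _-_)
open import Data.Product using (_×_; _,_; Σ; ∃; ∃-syntax)
open import Data.Sum using (_⊎_)
open import Data.Maybe using (Maybe; just; nothing)
open import Data.Sign using (Sign) renaming (_*_ to _⊙_)
open import Function.Definitions using (Injective)
open import Relation.Binary.PropositionalEquality using (_≡_)

-- Points of the infinite triangular lattice, in axial coordinates:
-- the lattice is {a·e₁ + b·e₂ : a,b ∈ ℤ} with e₁ = (1,0), e₂ = (1/2, √3/2).
Point : Set
Point = ℤ × ℤ

data Step : ℤ × ℤ → Set where
  e₁  : Step (+ 1 , + 0)
  e₁⁻ : Step (-[1+ 0 ] , + 0)
  e₂  : Step (+ 0 , + 1)
  e₂⁻ : Step (+ 0 , -[1+ 0 ])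
  e₃  : Step (+ 1 , -[1+ 0 ])
  e₃⁻ : Step (-[1+ 0 ] , + 1)

LatticeAdj : Point → Point → Set
LatticeAdj (a , b) (c , d) = Step (c - a , d - b)

record TriGrid (n : ℕ) : Set where
  field
    pos    : Fin n → Point
    pos-inj : Injective _≡_ _≡_ pos

  Adj : Fin n → Fin n → Set
  Adj u v = LatticeAdj (pos u) (pos v)

-- The signature is given as a symmetric function on pairs of vertices; only its
-- values on edges (adjacent pairs) are relevant.
record SignedTriGrid (n : ℕ) : Set where
  field
    grid   : TriGrid n
    sig    : Fin n → Fin n → Sign
    sig-sym : ∀ u v → sig u v ≡ sig v u
  open TriGrid grid public

-- A (target) signed graph on vertex set Fin m: a finite simple graph with a
-- signature. edge u v = nothing means no edge; just s means an edge of sign s.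
-- Simple: symmetric, no loops (a single sign per pair, so no parallel edges).
record SignedGraph (m : ℕ) : Set where
  field
    edge     : Fin m → Fin m → Maybe Sign
    edge-sym : ∀ u v → edge u v ≡ edge v u
    loopless : ∀ u → edge u u ≡ nothing

-- Homomorphism of signed graphs G → H: a vertex map φ together with a switching
-- set (σ v = - means v is switched) such that after switching, every edge uv of G
-- is mapped to an edge φ(u)φ(v) of H with the same sign.
Hom : ∀ {n m} → SignedTriGrid n → SignedGraph m → Set
Hom {n} {m} G H =
  Σ (Fin n → Sign) λ σ →
  Σ (Fin n → Fin m) λ φ →
  ∀ u v → SignedTriGrid.Adj G u v →
    SignedGraph.edge H (φ u) (φ v) ≡ just ((σ u ⊙ SignedTriGrid.sig G u v) ⊙ σ v)

χs≤ : ∀ {n} → SignedTriGrid n → ℕ → Set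
χs≤ G k = ∃[ m ] (m ≤ k × Σ (SignedGraph m) λ H → Hom G H)

module Submission where

-- The target H₁₀ is the complete graph on an apex and the nine cells of a 3 × 3
-- grid: the apex is joined positively to every cell, and two cells positively iff they share a
-- row or a column.  After a translation the triangular grid lies in a strip of the lattice, which
-- is coloured row by row; a colour is a vertex of H₁₀ together with a switching sign, and a new
-- vertex must be compatible with its left neighbour and its two lower neighbours.  Greedy choices
-- can get stuck, so each row is coloured by backward dynamic programming over the colours from
-- which the row can still be completed.  Two properties of H₁₀, checked by exhaustive computation,
-- make this work.  Any two coloured vertices on distinct vertices of H₁₀ have two common neighbours
-- on distinct vertices, which starts a row.  And for colours x ≢ y attached to A by the same sign,
-- the common neighbours of A and B adjacent to x or y cover two vertices; by induction from the
-- right end of the row this shows that among the colours fitting the lower-right neighbour at most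
-- one is a dead end, so the row never gets stuck.

open import Defs
open import Data.Bool using (Bool; T; if_then_else_; _∧_; _∨_)
open import Data.Bool.ListAction using (all; any)
open import Data.Bool.Properties using (T-∧)
open import Data.Empty using (⊥-elim)
open import Data.Fin using (Fin; zero; suc)
open import Data.Fin.Properties using (any?) renaming (_≟_ to _≟ᶠ_)
open import Data.Integer using (ℤ; -[1+_]; ∣_∣)
import Data.Integer as ℤ
import Data.Integer.Properties as ℤₚ
open import Algebra.Properties.AbelianGroup ℤₚ.+-0-abelianGroup using (//-rightDividesˡ; ⁻¹-anti-homo‿-)
open import Data.Integer.Tactic.RingSolver using (solve-∀)
open import Data.List using (allFin; tabulate)
import Data.List.Extrema
open import Data.List.Membership.Propositional.Properties using (∈-allFin)
import Data.List.Relation.Unary.All as All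
open import Data.List.Relation.Unary.All.Properties using (all⁺; all⁻; tabulate⁺; tabulate⁻)
import Data.List.Relation.Unary.Any as Any
open import Data.List.Relation.Unary.Any using (satisfied)
open import Data.List.Relation.Unary.Any.Properties using (any⁺; any⁻)
open import Data.Maybe using (Maybe; just; nothing)
import Data.Maybe.Properties as Maybe
open import Data.Nat using (ℕ; zero; suc; _≤_; _∸_)
import Data.Nat.Properties as ℕₚ
open import Data.Product using (_×_; _,_; proj₁; proj₂; Σ; ∃; ∃₂; ∃-syntax)
open import Data.Product.Properties using (≡-dec)
open import Data.Sign using (Sign; +; -) renaming (_*_ to _⊙_)
import Data.Sign.Properties as Sign
open import Algebra.Properties.CommutativeSemigroup Sign.*-commutativeSemigroup using (xy∙z≈zy∙x)
open import Data.Sum using (_⊎_; inj₁; inj₂)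
open import Data.Unit using (⊤; tt)
open import Function using (_∘_)
open import Function.Bundles using (Equivalence)
open import Relation.Binary.PropositionalEquality using (_≡_; _≢_; refl; sym; trans; cong; cong₂; subst; module ≡-Reasoning)
open import Relation.Nullary using (Dec; yes; no; ¬_; does; _×-dec_; _⊎-dec_; _→-dec_; ¬?)
open import Relation.Nullary.Decidable using (isYes; from-yes; toWitness; fromWitness; dec-true; dec-false; map′; T?)
open import Relation.Unary using (Decidable)

module Colouring {m : ℕ} (H : SignedGraph m) where
  open SignedGraph H

  -- The colour (p , σ) of a vertex: it is mapped to p, and switched iff σ is -.
  Colour : Set
  Colour = Fin m × Sign

  vertex : Colour → Fin m
  vertex = proj₁

  Compatible : Colour → Sign → Colour → Set
  Compatible (p , σ) s (q , τ) = edge p q ≡ just ((σ ⊙ s) ⊙ τ)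

  compatible? : ∀ c s d → Dec (Compatible c s d)
  compatible? (p , σ) s (q , τ) = Maybe.≡-dec Sign._≟_ (edge p q) (just ((σ ⊙ s) ⊙ τ))

  compatible-sym : ∀ {c s d} → Compatible c s d → Compatible d s c
  compatible-sym {p , σ} {s} {q , τ} e = trans (edge-sym q p) (trans e (cong just (xy∙z≈zy∙x σ s τ)))

  compatible⇒≢ : ∀ {c s d} → Compatible c s d → vertex c ≢ vertex d
  compatible⇒≢ {p , _} e refl with trans (sym (loopless p)) e
  ... | ()

  compatible-injective : ∀ {c d s A} → Compatible c s A → Compatible d s A → vertex c ≡ vertex d → c ≡ d
  compatible-injective {p , σ} {_ , τ} {s} {_ , α} e e′ refl =
    cong (p ,_) (Sign.*-cancelʳ-≡ s σ τ (Sign.*-cancelʳ-≡ α (σ ⊙ s) (τ ⊙ s) (Maybe.just-injective (trans (sym e) e′))))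

  _≟_ : (c d : Colour) → Dec (c ≡ d)
  _≟_ = ≡-dec _≟ᶠ_ Sign._≟_

  ∃-colour? : ∀ {P : Colour → Set} → Decidable P → Dec (∃ P)
  ∃-colour? P? with any? (λ p → P? (p , +) ⊎-dec P? (p , -))
  ... | yes (p , inj₁ h) = yes ((p , +) , h)
  ... | yes (p , inj₂ h) = yes ((p , -) , h)
  ... | no ¬h = no λ { ((p , +) , h) → ¬h (p , inj₁ h) ; ((p , -) , h) → ¬h (p , inj₂ h) }

  CommonNeighbour : Colour → Sign → Colour → Sign → Colour → Set
  CommonNeighbour A s B t c = Compatible c s A × Compatible c t B

  TwoVertices : (Colour → Set) → Set
  TwoVertices P = ∃₂ λ c d → vertex c ≢ vertex d × P c × P d

  TwoCommonNeighbours : Set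
  TwoCommonNeighbours = ∀ A s B t → vertex A ≢ vertex B → TwoVertices (CommonNeighbour A s B t)

  TwoCommonNeighboursNear : Set
  TwoCommonNeighboursNear = ∀ A s B t r u {x y} → vertex A ≢ vertex B → x ≢ y →
    Compatible x r A → Compatible y r A →
    TwoVertices (λ c → CommonNeighbour A s B t c × (Compatible c u x ⊎ Compatible c u y))

  MissesAtMostOne : (Colour → Set) → Colour → Sign → Set
  MissesAtMostOne F B t = ∀ {c d} → Compatible c t B → Compatible d t B → ¬ F c → ¬ F d → c ≡ d

  Extends : (Colour → Set) → (Colour → Set) → Sign → Colour → Set
  Extends N F u x = ∃[ c ] (Compatible c u x × N c) × F c

  -- Every common neighbour that could follow x or y is dead, and near provides two on distinct vertices.
  extends-missesAtMostOne : TwoCommonNeighboursNear → ∀ {A s B t u r F} → vertex A ≢ vertex B →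
    MissesAtMostOne F B t → MissesAtMostOne (Extends (CommonNeighbour A s B t) F u) A r
  extends-missesAtMostOne near {A} {s} {B} {t} {u} {r} {F} A≢B few {x} {y} xA yA ¬x ¬y with x ≟ y
  ... | yes x≡y = x≡y
  ... | no x≢y with near A s B t r u A≢B x≢y xA yA
  ...   | c , d , c≢d , (cN , cxy) , (dN , dxy) =
    ⊥-elim (c≢d (cong vertex (few {c} {d} (proj₂ cN) (proj₂ dN) (dead {c} cN cxy) (dead {d} dN dxy))))
    where
    dead : ∀ {c} → CommonNeighbour A s B t c → Compatible c u x ⊎ Compatible c u y → ¬ F c
    dead {c} cN (inj₁ cx) Fc = ¬x (c , (cx , cN) , Fc)
    dead {c} cN (inj₂ cy) Fc = ¬y (c , (cy , cN) , Fc)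

  commonNeighbour-in : TwoCommonNeighbours → ∀ {A s B t F} → vertex A ≢ vertex B → Decidable F →
    MissesAtMostOne F B t → ∃[ c ] CommonNeighbour A s B t c × F c
  commonNeighbour-in two {A} {s} {B} {t} A≢B F? few with two A s B t A≢B
  ... | c , d , c≢d , cN , dN with F? c | F? d
  ...   | yes Fc | _      = c , cN , Fc
  ...   | no _   | yes Fd = d , dN , Fd
  ...   | no ¬Fc | no ¬Fd = ⊥-elim (c≢d (cong vertex (few {c} {d} (proj₂ cN) (proj₂ dN) ¬Fc ¬Fd)))

data StripEdge : ℕ × ℕ → ℕ × ℕ → Set where
  row-edge      : ∀ i j → StripEdge (suc i , j) (i , j)
  column-edge   : ∀ i j → StripEdge (i , suc j) (i , j)
  diagonal-edge : ∀ i j → StripEdge (i , suc j) (suc i , j)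

module _ {m : ℕ} (H : SignedGraph m) where
  open Colouring H

  record StripColouring (W : ℕ) (sg : ℕ × ℕ → ℕ × ℕ → Sign) : Set where
    field
      colour     : ℕ × ℕ → Colour
      compatible : ∀ {p q} → StripEdge p q → proj₁ p ≤ W → Compatible (colour p) (sg p q) (colour q)

module Strip {m : ℕ} (H : SignedGraph (suc (suc m)))
             (two : Colouring.TwoCommonNeighbours H) (near : Colouring.TwoCommonNeighboursNear H) where
  open Colouring H

  Proper : (ℕ → Colour) → Set
  Proper row = ∀ k → vertex (row k) ≢ vertex (row (suc k))

  away : Colour → Colour
  away (zero , _)  = (suc zero , +)
  away (suc _ , _) = (zero , +)

  away-≢ : ∀ c → vertex c ≢ vertex (away c)
  away-≢ (zero , _) ()
  away-≢ (suc _ , _) ()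

  alternating : ℕ → Colour
  alternating zero    = (zero , +)
  alternating (suc k) = away (alternating k)

  record RowAbove (W : ℕ) (P : ℕ → Colour) (sL sY sZ : ℕ → Sign) : Set where
    field
      row        : ℕ → Colour
      proper     : Proper row
      horizontal : ∀ k → suc k ≤ W → Compatible (row (suc k)) (sL k) (row k)
      vertical   : ∀ k → k ≤ W → Compatible (row k) (sY k) (P k)
      diagonal   : ∀ k → k ≤ W → Compatible (row k) (sZ k) (P (suc k))

  module Above (W : ℕ) (P : ℕ → Colour) (P-proper : Proper P) (sL sY sZ : ℕ → Sign) where

    Fits : ℕ → Colour → Set
    Fits k = CommonNeighbour (P k) (sY k) (P (suc k)) (sZ k)

    Extendable : ℕ → ℕ → Colour → Set
    Extendable k zero    = λ _ → ⊤
    Extendable k (suc r) = Extends (Fits (suc k)) (Extendable (suc k) r) (sL k)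

    extendable? : ∀ k r → Decidable (Extendable k r)
    extendable? k zero    _ = yes tt
    extendable? k (suc r) x = ∃-colour? λ c →
      (compatible? c (sL k) x ×-dec compatible? c _ (P (suc k)) ×-dec compatible? c _ (P (suc (suc k))))
      ×-dec extendable? (suc k) r c

    extendable-missesAtMostOne : ∀ r k → MissesAtMostOne (Extendable k r) (P (suc k)) (sZ k)
    extendable-missesAtMostOne zero    k _ _ ¬⊤ _ = ⊥-elim (¬⊤ tt)
    extendable-missesAtMostOne (suc r) k =
      extends-missesAtMostOne near (P-proper (suc k)) (extendable-missesAtMostOne r (suc k))

    first : ∃[ c ] Fits 0 c × Extendable 0 W c
    first = commonNeighbour-in two (P-proper 0) (extendable? 0 W) (extendable-missesAtMostOne W 0)

    next : ∀ k r x → Dec (Extendable k r x) → Colour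
    next k (suc r) x (yes (c , _)) = c
    next k _       x _             = away x

    next-≢ : ∀ k r x d → vertex x ≢ vertex (next k r x d)
    next-≢ k zero    x _                            = away-≢ x
    next-≢ k (suc r) x (yes (c , (cx , _) , _)) = compatible⇒≢ {c} {sL k} {x} cx ∘ sym
    next-≢ k (suc r) x (no _)                       = away-≢ x

    next-extends : ∀ {k r r′} → r ≡ suc r′ → ∀ x d → Extendable k r x →
      Compatible (next k r x d) (sL k) x × Fits (suc k) (next k r x d) × Extendable (suc k) r′ (next k r x d)
    next-extends refl x (yes (c , (cx , cN) , e)) _ = cx , cN , e
    next-extends refl x (no ¬e)                   e = ⊥-elim (¬e e)

    cell : ℕ → Colour
    cell zero    = proj₁ first
    cell (suc k) = next k (W ∸ k) (cell k) (extendable? k (W ∸ k) (cell k))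

    cell-extendable : ∀ k → k ≤ W → Extendable k (W ∸ k) (cell k)
    cell-next : ∀ k → suc k ≤ W →
      Compatible (cell (suc k)) (sL k) (cell k) × Fits (suc k) (cell (suc k)) × Extendable (suc k) (W ∸ suc k) (cell (suc k))

    cell-extendable zero    _   = proj₂ (proj₂ first)
    cell-extendable (suc k) k<W = proj₂ (proj₂ (cell-next k k<W))

    cell-next k k<W = next-extends (ℕₚ.+-∸-assoc 1 k<W) (cell k) _ (cell-extendable k (ℕₚ.<⇒≤ k<W))

    cell-fits : ∀ k → k ≤ W → Fits k (cell k)
    cell-fits zero    _   = proj₁ (proj₂ first)
    cell-fits (suc k) k<W = proj₁ (proj₂ (cell-next k k<W))

    rowAbove : RowAbove W P sL sY sZ
    rowAbove = record
      { row        = cell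
      ; proper     = λ k → next-≢ k (W ∸ k) (cell k) _
      ; horizontal = λ k k<W → proj₁ (cell-next k k<W)
      ; vertical   = λ k k≤W → proj₁ (cell-fits k k≤W)
      ; diagonal   = λ k k≤W → proj₂ (cell-fits k k≤W)
      }

  strip-colouring : ∀ W sg → StripColouring H W sg
  strip-colouring W sg = record { colour = colour ; compatible = compatible }
    where
    sL sY sZ : ℕ → ℕ → Sign
    sL j i = sg (suc i , j) (i , j)
    -- The bottom lattice row is built above an auxiliary alternating row, with no real edges to it.
    sY zero    _ = +
    sY (suc j) i = sg (i , suc j) (i , j)
    sZ zero    _ = +
    sZ (suc j) i = sg (i , suc j) (suc i , j)

    below : ℕ → Σ (ℕ → Colour) Proper
    above : ∀ j → RowAbove W (proj₁ (below j)) (sL j) (sY j) (sZ j)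
    below zero    = alternating , away-≢ ∘ alternating
    below (suc j) = RowAbove.row (above j) , RowAbove.proper (above j)
    above j = Above.rowAbove W (proj₁ (below j)) (proj₂ (below j)) (sL j) (sY j) (sZ j)

    colour : ℕ × ℕ → Colour
    colour (i , j) = RowAbove.row (above j) i

    compatible : ∀ {p q} → StripEdge p q → proj₁ p ≤ W → Compatible (colour p) (sg p q) (colour q)
    compatible (row-edge i j)      = RowAbove.horizontal (above j) i
    compatible (column-edge i j)   = RowAbove.vertical (above (suc j)) i
    compatible (diagonal-edge i j) = RowAbove.diagonal (above (suc j)) i

private
  module ℤ-Extrema = Data.List.Extrema ℤₚ.≤-totalOrder
  module ℕ-Extrema = Data.List.Extrema ℕₚ.≤-totalOrder

  minus-plus : ∀ i j → i ≡ (i ℤ.- j) ℤ.+ j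
  minus-plus i j = sym (//-rightDividesˡ j i)

  minus-shift : ∀ i j o → i ℤ.- j ≡ (i ℤ.- o) ℤ.- (j ℤ.- o)
  minus-shift = solve-∀

  minus-swap : ∀ i j → i ℤ.- j ≡ ℤ.- (j ℤ.- i)
  minus-swap i j = sym (⁻¹-anti-homo‿- j i)

+-minus-+ : ∀ {a b k} → ℤ.+ a ℤ.- ℤ.+ b ≡ k → ℤ.+ a ≡ k ℤ.+ ℤ.+ b
+-minus-+ {a} {b} e = trans (minus-plus (ℤ.+ a) (ℤ.+ b)) (cong (ℤ._+ ℤ.+ b) e)

minus≡1 : ∀ {a b} → ℤ.+ a ℤ.- ℤ.+ b ≡ ℤ.+ 1 → a ≡ suc b
minus≡1 = ℤₚ.+-injective ∘ +-minus-+

minus≡0 : ∀ {a b} → ℤ.+ a ℤ.- ℤ.+ b ≡ ℤ.+ 0 → a ≡ b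
minus≡0 = ℤₚ.+-injective ∘ +-minus-+

minus≡-1 : ∀ {a b} → ℤ.+ a ℤ.- ℤ.+ b ≡ -[1+ 0 ] → b ≡ suc a
minus≡-1 {a} {b} e = minus≡1 (trans (minus-swap (ℤ.+ b) (ℤ.+ a)) (cong ℤ.-_ e))

step-stripEdge : ∀ {i j i′ j′ dx dy} → Step (dx , dy) → ℤ.+ i′ ℤ.- ℤ.+ i ≡ dx → ℤ.+ j′ ℤ.- ℤ.+ j ≡ dy →
  StripEdge (i′ , j′) (i , j) ⊎ StripEdge (i , j) (i′ , j′)
step-stripEdge {i} {j} {i′} {j′} e₁  ex ey rewrite minus≡1 {i′} {i} ex  | minus≡0 {j′} {j} ey  = inj₁ (row-edge _ _)
step-stripEdge {i} {j} {i′} {j′} e₁⁻ ex ey rewrite minus≡-1 {i′} {i} ex | minus≡0 {j′} {j} ey  = inj₂ (row-edge _ _)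
step-stripEdge {i} {j} {i′} {j′} e₂  ex ey rewrite minus≡0 {i′} {i} ex  | minus≡1 {j′} {j} ey  = inj₁ (column-edge _ _)
step-stripEdge {i} {j} {i′} {j′} e₂⁻ ex ey rewrite minus≡0 {i′} {i} ex  | minus≡-1 {j′} {j} ey = inj₂ (column-edge _ _)
step-stripEdge {i} {j} {i′} {j′} e₃  ex ey rewrite minus≡1 {i′} {i} ex  | minus≡-1 {j′} {j} ey = inj₂ (diagonal-edge _ _)
step-stripEdge {i} {j} {i′} {j′} e₃⁻ ex ey rewrite minus≡-1 {i′} {i} ex | minus≡1 {j′} {j} ey  = inj₁ (diagonal-edge _ _)

module Embedding {n : ℕ} (G : SignedTriGrid n) where
  open SignedTriGrid G

  offset : (Fin n → ℤ) → ℤ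
  offset f = ℤ-Extrema.min (ℤ.+ 0) (tabulate f)

  shifted : (Fin n → ℤ) → Fin n → ℕ
  shifted f u = ∣ f u ℤ.- offset f ∣

  +shifted : ∀ f u → ℤ.+ shifted f u ≡ f u ℤ.- offset f
  +shifted f u = ℤₚ.0≤i⇒+∣i∣≡i (ℤₚ.i≤j⇒0≤j-i (tabulate⁻ (ℤ-Extrema.min≤xs (ℤ.+ 0) (tabulate f)) u))

  shifted-minus : ∀ f u v → ℤ.+ shifted f v ℤ.- ℤ.+ shifted f u ≡ f v ℤ.- f u
  shifted-minus f u v rewrite +shifted f u | +shifted f v = sym (minus-shift (f v) (f u) (offset f))

  shifted-injective : ∀ f {u v} → shifted f u ≡ shifted f v → f u ≡ f v
  shifted-injective f {u} {v} e = begin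
    f u                      ≡⟨ minus-plus (f u) (offset f) ⟩
    (f u ℤ.- offset f) ℤ.+ offset f ≡⟨ cong (ℤ._+ offset f) (trans (sym (+shifted f u)) (trans (cong ℤ.+_ e) (+shifted f v))) ⟩
    (f v ℤ.- offset f) ℤ.+ offset f ≡⟨ sym (minus-plus (f v) (offset f)) ⟩
    f v                      ∎
    where open ≡-Reasoning

  point : Fin n → ℕ × ℕ
  point u = shifted (proj₁ ∘ pos) u , shifted (proj₂ ∘ pos) u

  point-injective : ∀ {u v} → point u ≡ point v → u ≡ v
  point-injective e = pos-inj (cong₂ _,_ (shifted-injective (proj₁ ∘ pos) (cong proj₁ e))
                                          (shifted-injective (proj₂ ∘ pos) (cong proj₂ e)))

  width : ℕ
  width = ℕ-Extrema.max 0 (tabulate (proj₁ ∘ point))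

  column≤width : ∀ u → proj₁ (point u) ≤ width
  column≤width = tabulate⁻ (ℕ-Extrema.xs≤max 0 (tabulate (proj₁ ∘ point)))

  adj-stripEdge : ∀ {u v} → Adj u v → StripEdge (point v) (point u) ⊎ StripEdge (point u) (point v)
  adj-stripEdge {u} {v} adj = step-stripEdge adj (shifted-minus (proj₁ ∘ pos) u v) (shifted-minus (proj₂ ∘ pos) u v)

  at? : ∀ p → Dec (∃ λ u → point u ≡ p)
  at? p = any? λ u → ≡-dec ℕₚ._≟_ ℕₚ._≟_ (point u) p

  signature : ℕ × ℕ → ℕ × ℕ → Sign
  signature p q with at? p | at? q
  ... | yes (u , _) | yes (v , _) = sig u v
  ... | _           | _           = +

  signature-point : ∀ u v → signature (point u) (point v) ≡ sig u v
  signature-point u v with at? (point u) | at? (point v)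
  ... | yes (u′ , e) | yes (v′ , e′) rewrite point-injective e | point-injective e′ = refl
  ... | yes _        | no ¬v         = ⊥-elim (¬v (v , refl))
  ... | no ¬u        | _             = ⊥-elim (¬u (u , refl))

  hom : ∀ {m} (H : SignedGraph m) → StripColouring H width signature → Hom G H
  hom H S = proj₂ ∘ c , proj₁ ∘ c , respects
    where
    open Colouring H
    open StripColouring S
    c : Fin n → Colour
    c = colour ∘ point
    respects : ∀ u v → Adj u v → Compatible (c u) (sig u v) (c v)
    respects u v adj with adj-stripEdge adj
    ... | inj₁ e = compatible-sym {c v} {sig u v} {c u}
      (subst (λ s → Compatible (c v) s (c u)) (trans (signature-point v u) (sig-sym v u)) (compatible e (column≤width v)))
    ... | inj₂ e = subst (λ s → Compatible (c u) s (c v)) (signature-point u v) (compatible e (column≤width u))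

∀-sign? : ∀ {P : Sign → Set} → Decidable P → Dec (∀ s → P s)
∀-sign? P? = map′ (λ { (p , q) + → p ; (p , q) - → q }) (λ h → h + , h -) (P? + ×-dec P? -)

Two : ∀ {n} → (Fin n → Set) → Set
Two P = ∃₂ λ v w → v ≢ w × P v × P w

-- Unlike Data.Fin.Properties.all? and any?, these decide by a plain Boolean fold, which keeps the
-- exhaustive checks on H₁₀ fast.
every? : ∀ {n} {P : Fin n → Set} → Decidable P → Dec (∀ v → P v)
every? {n} P? = map′ (λ h v → toWitness (All.lookup (all⁺ _ (allFin n) h) (∈-allFin v)))
                 (λ h → all⁻ (isYes ∘ P?) (tabulate⁺ {f = λ v → v} λ v → fromWitness {a? = P? v} (h v)))
                 (T? (all (isYes ∘ P?) (allFin n)))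

two? : ∀ {n} {P : Fin n → Set} → Decidable P → Dec (Two P)
two? {n} {P} P? = map′ sound complete (T? (any first (allFin n)))
  where
  apart? : ∀ v w → Dec (v ≢ w × P w)
  apart? v w = ¬? (v ≟ᶠ w) ×-dec P? w

  first : Fin n → Bool
  first v = isYes (P? v) ∧ any (isYes ∘ apart? v) (allFin n)

  sound : T (any first (allFin n)) → Two P
  sound h with satisfied (any⁻ first (allFin n) h)
  ... | v , hv with Equivalence.to (T-∧ {isYes (P? v)}) hv
  ...   | Pv , hw with satisfied (any⁻ (isYes ∘ apart? v) (allFin n) hw)
  ...     | w , hvw with toWitness {a? = apart? v w} hvw
  ...       | v≢w , Pw = v , w , v≢w , toWitness {a? = P? v} Pv , Pw

  complete : Two P → T (any first (allFin n))
  complete (v , w , v≢w , Pv , Pw) = any⁺ first (Any.map (λ { refl → first-v }) (∈-allFin v))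
    where
    first-v : T (first v)
    first-v = Equivalence.from T-∧ (fromWitness {a? = P? v} Pv ,
      any⁺ (isYes ∘ apart? v) (Any.map (λ { refl → fromWitness {a? = apart? v w} (v≢w , Pw) }) (∈-allFin w)))

module SignLaws where
  unswitch : ∀ x s α → x ≡ (((x ⊙ s) ⊙ α) ⊙ s) ⊙ α
  unswitch = from-yes (∀-sign? λ x → ∀-sign? λ s → ∀-sign? λ α → x Sign.≟ (((x ⊙ s) ⊙ α) ⊙ s) ⊙ α)

  second-neighbour : ∀ x y z s α t β → (x ⊙ y) ⊙ z ≡ ((s ⊙ α) ⊙ (t ⊙ β)) ⊙ y → z ≡ (((x ⊙ s) ⊙ α) ⊙ t) ⊙ β
  second-neighbour = from-yes (∀-sign? λ x → ∀-sign? λ y → ∀-sign? λ z → ∀-sign? λ s → ∀-sign? λ α → ∀-sign? λ t → ∀-sign? λ β →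
    ((x ⊙ y) ⊙ z Sign.≟ ((s ⊙ α) ⊙ (t ⊙ β)) ⊙ y) →-dec (z Sign.≟ (((x ⊙ s) ⊙ α) ⊙ t) ⊙ β))

  linked-neighbour : ∀ x y z s u r τ α → (x ⊙ y) ⊙ z ≡ (s ⊙ u) ⊙ r → y ≡ (τ ⊙ r) ⊙ α → x ≡ (((z ⊙ s) ⊙ α) ⊙ u) ⊙ τ
  linked-neighbour = from-yes (∀-sign? λ x → ∀-sign? λ y → ∀-sign? λ z → ∀-sign? λ s → ∀-sign? λ u → ∀-sign? λ r → ∀-sign? λ τ → ∀-sign? λ α →
    ((x ⊙ y) ⊙ z Sign.≟ (s ⊙ u) ⊙ r) →-dec (y Sign.≟ (τ ⊙ r) ⊙ α) →-dec (x Sign.≟ (((z ⊙ s) ⊙ α) ⊙ u) ⊙ τ))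

module Complete {m : ℕ} (S : Fin m → Fin m → Sign) (S-sym : ∀ p q → S p q ≡ S q p) where

  edge : Fin m → Fin m → Maybe Sign
  edge p q = if does (p ≟ᶠ q) then nothing else just (S p q)

  K : SignedGraph m
  K = record { edge = edge ; edge-sym = edge-sym ; loopless = loopless }
    where
    edge-sym : ∀ p q → edge p q ≡ edge q p
    edge-sym p q with p ≟ᶠ q
    ... | yes refl rewrite dec-true (p ≟ᶠ p) refl = refl
    ... | no p≢q rewrite dec-false (q ≟ᶠ p) (p≢q ∘ sym) = cong just (S-sym p q)
    loopless : ∀ p → edge p p ≡ nothing
    loopless p rewrite dec-true (p ≟ᶠ p) refl = refl

  open Colouring K

  compatible : ∀ {p σ s q τ} → p ≢ q → S p q ≡ (σ ⊙ s) ⊙ τ → Compatible (p , σ) s (q , τ)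
  compatible {p} {q = q} p≢q e rewrite dec-false (p ≟ᶠ q) p≢q = cong just e

  compatible-S : ∀ {p σ s q τ} → Compatible (p , σ) s (q , τ) → S p q ≡ (σ ⊙ s) ⊙ τ
  compatible-S {p} {σ} {s} {q} {τ} e with p ≟ᶠ q
  ... | no _ = Maybe.just-injective e

  triangle : Fin m → Fin m → Fin m → Sign
  triangle p q r = (S p q ⊙ S q r) ⊙ S p r

  Candidate : Fin m → Fin m → Sign → Fin m → Set
  Candidate a b π w = w ≢ a × w ≢ b × triangle w a b ≡ π

  Linked : Fin m → Sign → Fin m → Fin m → Set
  Linked a ρ x w = w ≢ x × triangle w x a ≡ ρ

  TwoCandidates : Set
  TwoCandidates = ∀ a b π → a ≢ b → Two (Candidate a b π)

  TwoLinkedCandidates : Set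
  TwoLinkedCandidates = ∀ a b π ρ x y → a ≢ b → x ≢ a → y ≢ a → x ≢ y →
    Two (λ w → Candidate a b π w × (Linked a ρ x w ⊎ Linked a ρ y w))

  toward : Colour → Sign → Fin m → Colour
  toward (a , α) s w = w , (S w a ⊙ s) ⊙ α

  -- The sign of the triangle formed by A, B and any of their common neighbours.
  commonTriangle : Colour → Sign → Colour → Sign → Sign
  commonTriangle (a , α) s (b , β) t = ((s ⊙ α) ⊙ (t ⊙ β)) ⊙ S a b

  toward-commonNeighbour : ∀ {A s B t w} → Candidate (vertex A) (vertex B) (commonTriangle A s B t) w →
    CommonNeighbour A s B t (toward A s w)
  toward-commonNeighbour {a , α} {s} {b , β} {t} {w} (w≢a , w≢b , wab) =
    compatible {σ = (S w a ⊙ s) ⊙ α} {s} {τ = α} w≢a (SignLaws.unswitch (S w a) s α) ,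
    compatible {σ = (S w a ⊙ s) ⊙ α} {t} {τ = β} w≢b (SignLaws.second-neighbour (S w a) (S a b) (S w b) s α t β wab)

  toward-linked : ∀ {A s u r x w} → Compatible x r A → Linked (vertex A) ((s ⊙ u) ⊙ r) (vertex x) w →
    Compatible (toward A s w) u x
  toward-linked {a , α} {s} {u} {r} {p , τ} {w} xA (w≢p , wpa) =
    compatible {σ = (S w a ⊙ s) ⊙ α} {u} {τ = τ} w≢p
      (SignLaws.linked-neighbour (S w p) (S p a) (S w a) s u r τ α wpa (compatible-S {σ = τ} {r} {τ = α} xA))

  twoCommonNeighbours : TwoCandidates → TwoCommonNeighbours
  twoCommonNeighbours two A s B t A≢B with two (vertex A) (vertex B) (commonTriangle A s B t) A≢B
  ... | v , w , v≢w , cv , cw = toward A s v , toward A s w , v≢w , toward-commonNeighbour cv , toward-commonNeighbour cw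

  twoCommonNeighboursNear : TwoLinkedCandidates → TwoCommonNeighboursNear
  twoCommonNeighboursNear two A s B t r u {x} {y} A≢B x≢y xA yA
    with two (vertex A) (vertex B) (commonTriangle A s B t) ((s ⊙ u) ⊙ r) (vertex x) (vertex y)
             A≢B (compatible⇒≢ {x} {r} {A} xA) (compatible⇒≢ {y} {r} {A} yA) (x≢y ∘ compatible-injective xA yA)
  ... | v , w , v≢w , (cv , lv) , (cw , lw) =
    toward A s v , toward A s w , v≢w , (toward-commonNeighbour cv , linked lv) , (toward-commonNeighbour cw , linked lw)
    where
    linked : ∀ {w} → Linked (vertex A) ((s ⊙ u) ⊙ r) (vertex x) w ⊎ Linked (vertex A) ((s ⊙ u) ⊙ r) (vertex y) w →
      Compatible (toward A s w) u x ⊎ Compatible (toward A s w) u y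
    linked (inj₁ l) = inj₁ (toward-linked {A} {s} {u} {r} {x} xA l)
    linked (inj₂ l) = inj₂ (toward-linked {A} {s} {u} {r} {y} yA l)

  candidate? : ∀ a b π → Decidable (Candidate a b π)
  candidate? a b π w = ¬? (w ≟ᶠ a) ×-dec ¬? (w ≟ᶠ b) ×-dec triangle w a b Sign.≟ π

  linked? : ∀ a ρ x → Decidable (Linked a ρ x)
  linked? a ρ x w = ¬? (w ≟ᶠ x) ×-dec triangle w x a Sign.≟ ρ

  twoCandidates? : Dec TwoCandidates
  twoCandidates? = every? λ a → every? λ b → ∀-sign? λ π → ¬? (a ≟ᶠ b) →-dec two? (candidate? a b π)

  twoLinkedCandidates? : Dec TwoLinkedCandidates
  twoLinkedCandidates? = every? λ a → every? λ b → ∀-sign? λ π → ∀-sign? λ ρ → every? λ x → every? λ y →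
    ¬? (a ≟ᶠ b) →-dec ¬? (x ≟ᶠ a) →-dec ¬? (y ≟ᶠ a) →-dec ¬? (x ≟ᶠ y) →-dec
    two? λ w → candidate? a b π w ×-dec (linked? a ρ x w ⊎-dec linked? a ρ y w)

-- The 3 × 3 grid position of a vertex of H₁₀; vertex 0 is the apex.
gridCell : Fin 10 → Maybe (Fin 3 × Fin 3)
gridCell zero = nothing
gridCell (suc zero) = just (zero , zero)
gridCell (suc (suc zero)) = just (zero , suc zero)
gridCell (suc (suc (suc zero))) = just (zero , suc (suc zero))
gridCell (suc (suc (suc (suc zero)))) = just (suc zero , zero)
gridCell (suc (suc (suc (suc (suc zero))))) = just (suc zero , suc zero)
gridCell (suc (suc (suc (suc (suc (suc zero)))))) = just (suc zero , suc (suc zero))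
gridCell (suc (suc (suc (suc (suc (suc (suc zero))))))) = just (suc (suc zero) , zero)
gridCell (suc (suc (suc (suc (suc (suc (suc (suc zero)))))))) = just (suc (suc zero) , suc zero)
gridCell (suc (suc (suc (suc (suc (suc (suc (suc (suc zero))))))))) = just (suc (suc zero) , suc (suc zero))

lineSign : Maybe (Fin 3 × Fin 3) → Maybe (Fin 3 × Fin 3) → Sign
lineSign (just (i , j)) (just (k , l)) = if does (i ≟ᶠ k) ∨ does (j ≟ᶠ l) then + else -
lineSign _              _              = +

does-≟-comm : ∀ {n} (i j : Fin n) → does (i ≟ᶠ j) ≡ does (j ≟ᶠ i)
does-≟-comm i j with i ≟ᶠ j
... | yes refl = sym (dec-true (i ≟ᶠ i) refl)
... | no i≢j   = sym (dec-false (j ≟ᶠ i) (i≢j ∘ sym))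

lineSign-sym : ∀ c d → lineSign c d ≡ lineSign d c
lineSign-sym (just (i , j)) (just (k , l)) rewrite does-≟-comm i k | does-≟-comm j l = refl
lineSign-sym (just _)       nothing        = refl
lineSign-sym nothing        (just _)       = refl
lineSign-sym nothing        nothing        = refl

S₁₀ : Fin 10 → Fin 10 → Sign
S₁₀ p q = lineSign (gridCell p) (gridCell q)

module H₁₀ = Complete S₁₀ (λ p q → lineSign-sym (gridCell p) (gridCell q))

twoCommonNeighbours₁₀ : Colouring.TwoCommonNeighbours H₁₀.K
twoCommonNeighbours₁₀ = H₁₀.twoCommonNeighbours (from-yes H₁₀.twoCandidates?)

twoCommonNeighboursNear₁₀ : Colouring.TwoCommonNeighboursNear H₁₀.K
twoCommonNeighboursNear₁₀ = H₁₀.twoCommonNeighboursNear (from-yes H₁₀.twoLinkedCandidates?)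

theorem3 : (n : ℕ) (G : SignedTriGrid n) → χs≤ G 10
theorem3 n G = 10 , ℕₚ.≤-refl , H₁₀.K ,
  Embedding.hom G H₁₀.K (Strip.strip-colouring H₁₀.K twoCommonNeighbours₁₀ twoCommonNeighboursNear₁₀ _ _)
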